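{- For all integers $a\ge 0$, $m\ge 2$ and $n\ge 1$, \[ S_m^{(a)}(n)=\binom{n+a}{a+1}\left[1+(n-1)(a+1)\sum_{k=2}^m c_{mk}\binom{a+k}{k}^{ -1}\binom{n+a+k-2}{k-2}\right]. \] In particular, for $a=1$, \[ 1^m+2^m+\cdots+n^m=\frac12 n(n+1)\left[1+2(n-1)\sum_{k=2}^m\frac{c_{mk}}{k+1}\binom{n+k-1}{k-2}\right],\quad m\ge 2. \]
   Context: For integers $m\ge0$, $n\ge1$: $S_m^{(0)}(n)=n^m$ and $S_m^{(a)}(n)=\sum_{i=1}^n S_m^{(a-1)}(i)$ for $a\ge1$. For an integer $k\ge 2$, $\psi_k$ is the polynomial in $n$ defined by $\psi_k(n)=n+(k-1)(n-1)\binom{n+k-2}{k-1}=n+\frac{(n-1)n(n+1)\cdots(n+k-2)}{(k-2)!}$. For $m\ge2$, the rational numbers $c_{mk}$, $2\le k\le m$, are the unique coefficients such that $n^m=\sum_{k=2}^m c_{mk}\psi_k(n)$ as polynomials in $n$. -}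

module Defs where

open import Data.Nat using (ℕ; zero; suc; _^_; _∸_)
import Data.Nat as ℕ
open import Data.Nat.Combinatorics using (_C_)
open import Data.Integer using (+_)
open import Data.Rational using (ℚ; 0ℚ; 1ℚ; _/_; _+_; _-_; _*_)

⟦_⟧ : ℕ → ℚ
⟦ n ⟧ = + n / 1

-- reciprocal of a natural number (only ever applied to positive binomials)
recipℕ : ℕ → ℚ
recipℕ zero    = 0ℚ
recipℕ (suc d) = + 1 / suc d

sum1ℕ : ℕ → (ℕ → ℕ) → ℕ
sum1ℕ zero    g = 0
sum1ℕ (suc n) g = sum1ℕ n g ℕ.+ g (suc n)

-- Σ_{k=2}^{m} f k  (rationals)
sum2 : ℕ → (ℕ → ℚ) → ℚ
sum2 zero          f = 0ℚ
sum2 (suc zero)    f = 0ℚ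
sum2 (suc (suc j)) f = sum2 (suc j) f + f (suc (suc j))

S : ℕ → ℕ → ℕ → ℕ
S m zero    n = n ^ m
S m (suc a) n = sum1ℕ n (λ i → S m a i)

ψ : ℕ → ℕ → ℚ
ψ k x = ⟦ x ⟧ + (⟦ k ∸ 1 ⟧ * ((⟦ x ⟧ - 1ℚ) * ⟦ (x ℕ.+ k ∸ 2) C (k ∸ 1) ⟧))

{-# OPTIONS --safe #-}
module Submission where

-- Writing k = 2 + j, absorption gives ψ_k(x) = x + k(k-1) binom(x+k-2, k), so ψ_k is a
-- combination of the binomials binom(x+p, q+1), whose a-fold iterated sums are again
-- binomials by the hockey-stick identity.  Summing the expansion of x^m termwise, the
-- x part of every ψ_k contributes binom(n+a, a+1) with total weight Σ c_k = 1 (evaluate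
-- the expansion at x = 1, where ψ_k(1) = 1), and the remaining part is rewritten through
-- a factorial identity into the product form of the theorem.

open import Defs

module Binomial where
  open import Data.Nat
  open import Data.Nat.Properties
  open import Data.Nat.Combinatorics
  open import Data.Nat.DivMod using (m/n*n≡m)
  open import Relation.Binary.PropositionalEquality
  open import Data.Nat.Tactic.RingSolver using (solve-∀)
  open ≡-Reasoning

  private
    *-nonZero : ∀ {m n} → NonZero m → NonZero n → NonZero (m * n)
    *-nonZero {m} {n} m≢0 n≢0 = m*n≢0 m n {{m≢0}} {{n≢0}}

  C-factorial : ∀ {n} r s → r + s ≡ n → (n C s) * (s ! * r !) ≡ n !
  C-factorial r s refl = begin
    ((r + s) C s) * (s ! * r !)  ≡⟨ cong (λ t → ((r + s) C s) * (s ! * t !)) (m+n∸n≡m r s) ⟨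
    ((r + s) C s) * d            ≡⟨ cong (_* d) (nCk≡n!/k![n-k]! s≤r+s) ⟩
    ((r + s) ! / d) {{d≢0}} * d  ≡⟨ m/n*n≡m {{d≢0}} (k![n∸k]!∣n! s≤r+s) ⟩
    (r + s) !                    ∎
    where
    s≤r+s : s ≤ r + s
    s≤r+s = m≤n+m s r
    d : ℕ
    d = s ! * (r + s ∸ s) !
    d≢0 : NonZero d
    d≢0 = s !* (r + s ∸ s) !≢0

  C-nonZero : ∀ {n} r s → r + s ≡ n → NonZero (n C s)
  C-nonZero {n} r s eq = m*n≢0⇒m≢0 (n C s) {{subst NonZero (sym (C-factorial r s eq)) (n !≢0)}}

  C-absorption : ∀ r s → r * ((r + s) C s) ≡ suc s * ((r + s) C suc s)
  C-absorption zero s = sym (trans (cong (suc s *_) (k>n⇒nCk≡0 (n<1+n s))) (*-zeroʳ (suc s)))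
  C-absorption (suc t) s = *-cancelʳ-≡ _ _ (s ! * t !) {{*-nonZero (s !≢0) (t !≢0)}} (begin
    suc t * X * (s ! * t !)    ≡⟨ move-factor t X (s !) (t !) ⟩
    X * (s ! * (suc t) !)      ≡⟨ C-factorial (suc t) s refl ⟩
    (suc t + s) !              ≡⟨ C-factorial t (suc s) (+-suc t s) ⟨
    X′ * ((suc s) ! * t !)     ≡⟨ move-factor′ s X′ (s !) (t !) ⟩
    suc s * X′ * (s ! * t !)   ∎)
    where
    X X′ : ℕ
    X = (suc t + s) C s
    X′ = (suc t + s) C suc s
    move-factor : ∀ u x f g → suc u * x * (f * g) ≡ x * (f * (suc u * g))
    move-factor = solve-∀
    move-factor′ : ∀ u x f g → x * (suc u * f * g) ≡ suc u * x * (f * g)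
    move-factor′ = solve-∀

  -- With n = y + 1, k = j + 2 and N = n + a + k - 2 this is
  -- k(k-1) binom(N, a+k) binom(a+k, k) = binom(n+a, a+1) (n-1)(a+1) binom(N, k-2);
  -- for n ≥ 2 both sides times z! a! j! (a+k)! (n+a)! (z = n-2) equal N! (a+k)! (n+a)!.
  C-revision : ∀ y a j →
    (2 + j) * (1 + j) * ((suc y + a + j) C (a + (2 + j))) * ((a + (2 + j)) C (2 + j))
      ≡ ((suc y + a) C suc a) * (y * suc a) * ((suc y + a + j) C j)
  C-revision zero a j = begin
    (2 + j) * (1 + j) * (N C M) * (M C (2 + j))   ≡⟨ cong (λ t → (2 + j) * (1 + j) * t * (M C (2 + j))) (k>n⇒nCk≡0 N<M) ⟩
    (2 + j) * (1 + j) * 0 * (M C (2 + j))         ≡⟨ cong (_* (M C (2 + j))) (*-zeroʳ ((2 + j) * (1 + j))) ⟩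
    0                                             ≡⟨ cong (_* (N C j)) (*-zeroʳ (suc a C suc a)) ⟨
    (suc a C suc a) * 0 * (N C j)                 ∎
    where
    M N : ℕ
    M = a + (2 + j)
    N = suc a + j
    N<M : N < M
    N<M = subst (_< M) (+-suc a j) (+-monoʳ-< a (n<1+n (suc j)))
  C-revision (suc z) a j = *-cancelʳ-≡ _ _ (z ! * a ! * j ! * M ! * F !) {{Φ≢0}} (begin
    (2 + j) * (1 + j) * (N C M) * (M C (2 + j)) * (z ! * a ! * j ! * M ! * F !)
      ≡⟨ regroupˡ j (N C M) (M C (2 + j)) (z !) (a !) (j !) (M !) (F !) ⟩
    (N C M) * (M ! * z !) * ((M C (2 + j)) * ((2 + j) ! * a !)) * F !
      ≡⟨ cong₂ (λ u v → u * v * F !) (C-factorial z M z+M≡N) (C-factorial a (2 + j) refl) ⟩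
    N ! * M ! * F !
      ≡⟨ rotate (N !) (M !) (F !) ⟩
    F ! * N ! * M !
      ≡⟨ cong₂ (λ u v → u * v * M !) (C-factorial (suc z) (suc a) (+-suc (suc z) a)) (C-factorial F j refl) ⟨
    (F C suc a) * ((suc a) ! * (suc z) !) * ((N C j) * (j ! * F !)) * M !
      ≡⟨ regroupʳ z a (F C suc a) (N C j) (z !) (a !) (j !) (M !) (F !) ⟩
    (F C suc a) * (suc z * suc a) * (N C j) * (z ! * a ! * j ! * M ! * F !) ∎)
    where
    M F N : ℕ
    M = a + (2 + j)
    F = suc (suc z) + a
    N = F + j
    Φ≢0 : NonZero (z ! * a ! * j ! * M ! * F !)
    Φ≢0 = *-nonZero (*-nonZero (*-nonZero (*-nonZero (z !≢0) (a !≢0)) (j !≢0)) (M !≢0)) (F !≢0)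
    shift : ∀ z a j → z + (a + (2 + j)) ≡ suc (suc z) + a + j
    shift = solve-∀
    z+M≡N : z + M ≡ N
    z+M≡N = shift z a j
    regroupˡ : ∀ j A B fz fa fj fM fF →
      (2 + j) * (1 + j) * A * B * (fz * fa * fj * fM * fF)
        ≡ A * (fM * fz) * (B * ((2 + j) * ((1 + j) * fj) * fa)) * fF
    regroupˡ = solve-∀
    rotate : ∀ x y w → x * y * w ≡ w * x * y
    rotate = solve-∀
    regroupʳ : ∀ z a E D fz fa fj fM fF →
      E * (suc a * fa * (suc z * fz)) * (D * (fj * fF)) * fM
        ≡ E * (suc z * suc a) * D * (fz * fa * fj * fM * fF)
    regroupʳ = solve-∀

  C-hockey-stick : ∀ {p q} → p ≤ q → ∀ n → sum1ℕ n (λ i → (i + p) C suc q) ≡ (n + suc p) C suc (suc q)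
  C-hockey-stick p≤q zero = sym (k>n⇒nCk≡0 (s≤s (s≤s p≤q)))
  C-hockey-stick {p} {q} p≤q (suc n) rewrite C-hockey-stick p≤q n | +-suc n p =
    trans (+-comm (suc (n + p) C suc (suc q)) (suc (n + p) C suc q)) (nCk+nC[k+1]≡[n+1]C[k+1] (suc (n + p)) (suc q))

  [1+n]Cn≡1+n : ∀ n → suc n C n ≡ suc n
  [1+n]Cn≡1+n n = begin
    suc n C n             ≡⟨ nCk≡nC[n∸k] (n≤1+n n) ⟩
    suc n C (suc n ∸ n)   ≡⟨ cong (suc n C_) (m+n∸n≡m 1 n) ⟩
    suc n C 1             ≡⟨ nC1≡n (suc n) ⟩
    suc n                 ∎

  2*[n+1]C2≡n*[1+n] : ∀ n → 2 * ((n + 1) C 2) ≡ n * suc n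
  2*[n+1]C2≡n*[1+n] n = begin
    2 * ((n + 1) C 2)     ≡⟨ C-absorption n 1 ⟨
    n * ((n + 1) C 1)     ≡⟨ cong (n *_) (trans (nC1≡n (n + 1)) (+-comm n 1)) ⟩
    n * suc n             ∎

open import Data.Nat using (ℕ; zero; suc; _^_; _∸_; _≤_; NonZero; s≤s; z≤n)
import Data.Nat as ℕ
import Data.Nat.Properties as ℕP
open import Data.Nat.Combinatorics using (_C_; nC1≡n; k>n⇒nCk≡0)
import Data.Integer as ℤ
import Data.Integer.Properties as ℤP
open import Data.Rational using (ℚ; 0ℚ; 1ℚ; ½; _+_; _*_; _-_; toℚᵘ)
open import Data.Rational.Properties
import Data.Rational.Unnormalised as ℚᵘ
import Data.Rational.Unnormalised.Properties as ℚᵘP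
open import Data.Product using (_×_; _,_)
open import Level using (0ℓ)
open import Relation.Binary.PropositionalEquality
open import Relation.Nullary.Decidable using (dec⇒maybe)
open import Tactic.RingSolver using (solve-∀)
open import Tactic.RingSolver.Core.AlmostCommutativeRing using (AlmostCommutativeRing; fromCommutativeRing)

open Binomial

ℚ-ring : AlmostCommutativeRing 0ℓ 0ℓ
ℚ-ring = fromCommutativeRing +-*-commutativeRing (λ x → dec⇒maybe (0ℚ ≟ x))

-- ⟦ n ⟧ is normalised by a gcd computation that is stuck on open terms, so its
-- arithmetic is transported from ℚᵘ, where ⟦ n ⟧ is simply n / 1.
toℚᵘ-⟦⟧ : ∀ n → toℚᵘ ⟦ n ⟧ ℚᵘ.≃ ℚᵘ.mkℚᵘ (ℤ.+ n) 0
toℚᵘ-⟦⟧ n = toℚᵘ-fromℚᵘ (ℚᵘ.mkℚᵘ (ℤ.+ n) 0)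

⟦⟧-homo-+ : ∀ a b → ⟦ a ℕ.+ b ⟧ ≡ ⟦ a ⟧ + ⟦ b ⟧
⟦⟧-homo-+ a b = toℚᵘ-injective (ℚᵘP.≃-trans (toℚᵘ-⟦⟧ (a ℕ.+ b))
  (ℚᵘP.≃-trans (ℚᵘ.*≡* numerators)
    (ℚᵘP.≃-sym (ℚᵘP.≃-trans (toℚᵘ-homo-+ ⟦ a ⟧ ⟦ b ⟧) (ℚᵘP.+-cong (toℚᵘ-⟦⟧ a) (toℚᵘ-⟦⟧ b))))))
  where
  numerators : ℤ.+ (a ℕ.+ b) ℤ.* ℤ.+ 1 ≡ ((ℤ.+ a) ℤ.* ℤ.+ 1 ℤ.+ (ℤ.+ b) ℤ.* ℤ.+ 1) ℤ.* ℤ.+ 1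
  numerators rewrite ℤP.*-identityʳ (ℤ.+ a) | ℤP.*-identityʳ (ℤ.+ b) = cong (ℤ._* ℤ.+ 1) (ℤP.pos-+ a b)

⟦⟧-homo-* : ∀ a b → ⟦ a ℕ.* b ⟧ ≡ ⟦ a ⟧ * ⟦ b ⟧
⟦⟧-homo-* a b = toℚᵘ-injective (ℚᵘP.≃-trans (toℚᵘ-⟦⟧ (a ℕ.* b))
  (ℚᵘP.≃-trans (ℚᵘ.*≡* numerators)
    (ℚᵘP.≃-sym (ℚᵘP.≃-trans (toℚᵘ-homo-* ⟦ a ⟧ ⟦ b ⟧) (ℚᵘP.*-cong (toℚᵘ-⟦⟧ a) (toℚᵘ-⟦⟧ b))))))
  where
  numerators : ℤ.+ (a ℕ.* b) ℤ.* ℤ.+ 1 ≡ (ℤ.+ a ℤ.* ℤ.+ b) ℤ.* ℤ.+ 1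
  numerators = cong (ℤ._* ℤ.+ 1) (ℤP.pos-* a b)

recipℕ-inverseʳ : ∀ d → .{{NonZero d}} → ⟦ d ⟧ * recipℕ d ≡ 1ℚ
recipℕ-inverseʳ (suc b) = toℚᵘ-injective (ℚᵘP.≃-trans (toℚᵘ-homo-* ⟦ suc b ⟧ (recipℕ (suc b)))
  (ℚᵘP.≃-trans (ℚᵘP.*-cong (toℚᵘ-⟦⟧ (suc b)) (toℚᵘ-fromℚᵘ (ℚᵘ.mkℚᵘ (ℤ.+ 1) b))) (ℚᵘ.*≡* numerators)))
  where
  numerators : (ℤ.+ suc b ℤ.* ℤ.+ 1) ℤ.* ℤ.+ 1 ≡ ℤ.+ 1 ℤ.* (ℤ.+ 1 ℤ.* ℤ.+ suc b)
  numerators = trans (ℤP.*-identityʳ (ℤ.+ suc b ℤ.* ℤ.+ 1)) (trans (ℤP.*-identityʳ (ℤ.+ suc b))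
    (sym (trans (ℤP.*-identityˡ (ℤ.+ 1 ℤ.* ℤ.+ suc b)) (ℤP.*-identityˡ (ℤ.+ suc b)))))

⟦⟧-divide : ∀ x y d → .{{_ : NonZero d}} → x ℕ.* d ≡ y → ⟦ x ⟧ ≡ ⟦ y ⟧ * recipℕ d
⟦⟧-divide x y d x*d≡y = begin
  ⟦ x ⟧                        ≡⟨ *-identityʳ ⟦ x ⟧ ⟨
  ⟦ x ⟧ * 1ℚ                   ≡⟨ cong (⟦ x ⟧ *_) (recipℕ-inverseʳ d) ⟨
  ⟦ x ⟧ * (⟦ d ⟧ * recipℕ d)   ≡⟨ *-assoc ⟦ x ⟧ ⟦ d ⟧ (recipℕ d) ⟨
  ⟦ x ⟧ * ⟦ d ⟧ * recipℕ d     ≡⟨ cong (_* recipℕ d) (trans (sym (⟦⟧-homo-* x d)) (cong ⟦_⟧ x*d≡y)) ⟩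
  ⟦ y ⟧ * recipℕ d             ∎
  where open ≡-Reasoning

sum1ℚ : ℕ → (ℕ → ℚ) → ℚ
sum1ℚ zero    f = 0ℚ
sum1ℚ (suc n) f = sum1ℚ n f + f (suc n)

iterSum : ℕ → (ℕ → ℚ) → ℕ → ℚ
iterSum zero    f = f
iterSum (suc a) f n = sum1ℚ n (iterSum a f)

⟦sum1ℕ⟧ : ∀ n g → ⟦ sum1ℕ n g ⟧ ≡ sum1ℚ n (λ i → ⟦ g i ⟧)
⟦sum1ℕ⟧ zero    g = refl
⟦sum1ℕ⟧ (suc n) g = trans (⟦⟧-homo-+ (sum1ℕ n g) (g (suc n))) (cong (_+ ⟦ g (suc n) ⟧) (⟦sum1ℕ⟧ n g))

sum1ℚ-cong : ∀ n {f g : ℕ → ℚ} → (∀ i → f i ≡ g i) → sum1ℚ n f ≡ sum1ℚ n g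
sum1ℚ-cong zero    f≗g = refl
sum1ℚ-cong (suc n) f≗g = cong₂ _+_ (sum1ℚ-cong n f≗g) (f≗g (suc n))

sum1ℚ-zero : ∀ n → sum1ℚ n (λ _ → 0ℚ) ≡ 0ℚ
sum1ℚ-zero zero    = refl
sum1ℚ-zero (suc n) = trans (+-identityʳ _) (sum1ℚ-zero n)

+-interchange : ∀ (w x y z : ℚ) → (w + x) + (y + z) ≡ (w + y) + (x + z)
+-interchange = solve-∀ ℚ-ring

sum1ℚ-+ : ∀ n (f g : ℕ → ℚ) → sum1ℚ n (λ i → f i + g i) ≡ sum1ℚ n f + sum1ℚ n g
sum1ℚ-+ zero    f g = sym (+-identityʳ 0ℚ)
sum1ℚ-+ (suc n) f g = trans (cong (_+ (f (suc n) + g (suc n))) (sum1ℚ-+ n f g))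
  (+-interchange (sum1ℚ n f) (sum1ℚ n g) (f (suc n)) (g (suc n)))

sum1ℚ-*ˡ : ∀ n r (f : ℕ → ℚ) → sum1ℚ n (λ i → r * f i) ≡ r * sum1ℚ n f
sum1ℚ-*ˡ zero    r f = sym (*-zeroʳ r)
sum1ℚ-*ˡ (suc n) r f = trans (cong (_+ r * f (suc n)) (sum1ℚ-*ˡ n r f))
  (sym (*-distribˡ-+ r (sum1ℚ n f) (f (suc n))))

iterSum-cong : ∀ a n {f g : ℕ → ℚ} → (∀ i → f i ≡ g i) → iterSum a f n ≡ iterSum a g n
iterSum-cong zero    n f≗g = f≗g n
iterSum-cong (suc a) n f≗g = sum1ℚ-cong n (λ i → iterSum-cong a i f≗g)

iterSum-zero : ∀ a n → iterSum a (λ _ → 0ℚ) n ≡ 0ℚ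
iterSum-zero zero    n = refl
iterSum-zero (suc a) n = trans (sum1ℚ-cong n (iterSum-zero a)) (sum1ℚ-zero n)

iterSum-+ : ∀ a n (f g : ℕ → ℚ) → iterSum a (λ x → f x + g x) n ≡ iterSum a f n + iterSum a g n
iterSum-+ zero    n f g = refl
iterSum-+ (suc a) n f g = trans (sum1ℚ-cong n (λ i → iterSum-+ a i f g)) (sum1ℚ-+ n (iterSum a f) (iterSum a g))

iterSum-*ˡ : ∀ a n r (f : ℕ → ℚ) → iterSum a (λ x → r * f x) n ≡ r * iterSum a f n
iterSum-*ˡ zero    n r f = refl
iterSum-*ˡ (suc a) n r f = trans (sum1ℚ-cong n (λ i → iterSum-*ˡ a i r f)) (sum1ℚ-*ˡ n r (iterSum a f))

iterSum-sum2 : ∀ a n m (f : ℕ → ℕ → ℚ) →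
  iterSum a (λ x → sum2 m (λ k → f k x)) n ≡ sum2 m (λ k → iterSum a (f k) n)
iterSum-sum2 a n zero          f = iterSum-zero a n
iterSum-sum2 a n (suc zero)    f = iterSum-zero a n
iterSum-sum2 a n (suc (suc j)) f = trans (iterSum-+ a n (λ x → sum2 (suc j) (λ k → f k x)) (f (suc (suc j))))
  (cong (_+ iterSum a (f (suc (suc j))) n) (iterSum-sum2 a n (suc j) f))

⟦S⟧ : ∀ m a n → ⟦ S m a n ⟧ ≡ iterSum a (λ x → ⟦ x ^ m ⟧) n
⟦S⟧ m zero    n = refl
⟦S⟧ m (suc a) n = trans (⟦sum1ℕ⟧ n (S m a)) (sum1ℚ-cong n (λ i → ⟦S⟧ m a i))

iterSum-binomial : ∀ {p q} → p ≤ q → ∀ a n →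
  iterSum a (λ x → ⟦ (x ℕ.+ p) C suc q ⟧) n ≡ ⟦ (n ℕ.+ (a ℕ.+ p)) C suc (a ℕ.+ q) ⟧
iterSum-binomial p≤q zero    n = refl
iterSum-binomial p≤q (suc a) n = trans (sum1ℚ-cong n (iterSum-binomial p≤q a))
  (trans (sym (⟦sum1ℕ⟧ n _)) (cong ⟦_⟧ (C-hockey-stick (ℕP.+-monoʳ-≤ a p≤q) n)))

iterSum-id : ∀ a n → iterSum a ⟦_⟧ n ≡ ⟦ (n ℕ.+ a) C suc a ⟧
iterSum-id a n = begin
  iterSum a ⟦_⟧ n                                 ≡⟨ iterSum-cong a n (λ x → cong ⟦_⟧ (x≡[x+0]C1 x)) ⟩
  iterSum a (λ x → ⟦ (x ℕ.+ 0) C 1 ⟧) n           ≡⟨ iterSum-binomial z≤n a n ⟩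
  ⟦ (n ℕ.+ (a ℕ.+ 0)) C suc (a ℕ.+ 0) ⟧          ≡⟨ cong (λ t → ⟦ (n ℕ.+ t) C suc t ⟧) (ℕP.+-identityʳ a) ⟩
  ⟦ (n ℕ.+ a) C suc a ⟧                           ∎
  where
  open ≡-Reasoning
  x≡[x+0]C1 : ∀ x → x ≡ (x ℕ.+ 0) C 1
  x≡[x+0]C1 x = sym (trans (nC1≡n (x ℕ.+ 0)) (ℕP.+-identityʳ x))

sum2-cong : ∀ m {f g : ℕ → ℚ} → (∀ j → f (2 ℕ.+ j) ≡ g (2 ℕ.+ j)) → sum2 m f ≡ sum2 m g
sum2-cong zero          f≗g = refl
sum2-cong (suc zero)    f≗g = refl
sum2-cong (suc (suc j)) f≗g = cong₂ _+_ (sum2-cong (suc j) f≗g) (f≗g j)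

sum2-+ : ∀ m (f g : ℕ → ℚ) → sum2 m (λ k → f k + g k) ≡ sum2 m f + sum2 m g
sum2-+ zero          f g = sym (+-identityʳ 0ℚ)
sum2-+ (suc zero)    f g = sym (+-identityʳ 0ℚ)
sum2-+ (suc (suc j)) f g = trans (cong (_+ (f (2 ℕ.+ j) + g (2 ℕ.+ j))) (sum2-+ (suc j) f g))
  (+-interchange (sum2 (suc j) f) (sum2 (suc j) g) (f (2 ℕ.+ j)) (g (2 ℕ.+ j)))

sum2-*ˡ : ∀ m r (f : ℕ → ℚ) → sum2 m (λ k → r * f k) ≡ r * sum2 m f
sum2-*ˡ zero          r f = sym (*-zeroʳ r)
sum2-*ˡ (suc zero)    r f = sym (*-zeroʳ r)
sum2-*ˡ (suc (suc j)) r f = trans (cong (_+ r * f (2 ℕ.+ j)) (sum2-*ˡ (suc j) r f))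
  (sym (*-distribˡ-+ r (sum2 (suc j) f) (f (2 ℕ.+ j))))

sum2-*ʳ : ∀ m r (f : ℕ → ℚ) → sum2 m (λ k → f k * r) ≡ sum2 m f * r
sum2-*ʳ m r f = trans (sum2-cong m (λ j → *-comm (f (2 ℕ.+ j)) r)) (trans (sum2-*ˡ m r f) (*-comm r (sum2 m f)))

m+[2+j]∸2≡m+j : ∀ m j → m ℕ.+ (2 ℕ.+ j) ∸ 2 ≡ m ℕ.+ j
m+[2+j]∸2≡m+j m j = ℕP.+-∸-assoc m (s≤s (s≤s z≤n))

⟦1+n⟧-1≡⟦n⟧ : ∀ n → ⟦ suc n ⟧ - 1ℚ ≡ ⟦ n ⟧
⟦1+n⟧-1≡⟦n⟧ n = trans (cong (_- 1ℚ) (⟦⟧-homo-+ 1 n)) (p+q-p≡q 1ℚ ⟦ n ⟧)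
  where
  p+q-p≡q : ∀ (p q : ℚ) → p + q - p ≡ q
  p+q-p≡q = solve-∀ ℚ-ring

ψ-binomial : ∀ j x → ψ (2 ℕ.+ j) x ≡ ⟦ x ⟧ + ⟦ (2 ℕ.+ j) ℕ.* (1 ℕ.+ j) ⟧ * ⟦ (x ℕ.+ j) C (2 ℕ.+ j) ⟧
ψ-binomial j x = trans (cong (λ t → ⟦ x ⟧ + ⟦ suc j ⟧ * ((⟦ x ⟧ - 1ℚ) * ⟦ t C suc j ⟧)) (m+[2+j]∸2≡m+j x j)) (shifted x)
  where
  open ≡-Reasoning
  K : ℚ
  K = ⟦ (2 ℕ.+ j) ℕ.* (1 ℕ.+ j) ⟧
  shifted : ∀ x → ⟦ x ⟧ + ⟦ suc j ⟧ * ((⟦ x ⟧ - 1ℚ) * ⟦ (x ℕ.+ j) C suc j ⟧) ≡ ⟦ x ⟧ + K * ⟦ (x ℕ.+ j) C (2 ℕ.+ j) ⟧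
  shifted zero = begin
    0ℚ + ⟦ suc j ⟧ * ((0ℚ - 1ℚ) * ⟦ j C suc j ⟧)≡⟨ cong (λ t → 0ℚ + ⟦ suc j ⟧ * ((0ℚ - 1ℚ) * ⟦ t ⟧)) (k>n⇒nCk≡0 (ℕP.n<1+n j)) ⟩
    0ℚ + ⟦ suc j ⟧ * ((0ℚ - 1ℚ) * 0ℚ)≡⟨ cong (0ℚ +_) (*-zeroʳ ⟦ suc j ⟧) ⟩
    0ℚ + 0ℚ                                    ≡⟨ cong (0ℚ +_) (*-zeroʳ K) ⟨
    0ℚ + K * 0ℚ                                ≡⟨ cong (λ t → 0ℚ + K * ⟦ t ⟧) (k>n⇒nCk≡0 (ℕP.m<n⇒m<1+n (ℕP.n<1+n j))) ⟨
    0ℚ + K * ⟦ j C (2 ℕ.+ j) ⟧                 ∎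
  shifted (suc y) = begin
    ⟦ suc y ⟧ + ⟦ suc j ⟧ * ((⟦ suc y ⟧ - 1ℚ) * ⟦ C₁ ⟧) ≡⟨ cong (λ t → ⟦ suc y ⟧ + ⟦ suc j ⟧ * (t * ⟦ C₁ ⟧)) (⟦1+n⟧-1≡⟦n⟧ y) ⟩
    ⟦ suc y ⟧ + ⟦ suc j ⟧ * (⟦ y ⟧ * ⟦ C₁ ⟧)            ≡⟨ cong (λ t → ⟦ suc y ⟧ + ⟦ suc j ⟧ * t) (⟦⟧-homo-* y C₁) ⟨
    ⟦ suc y ⟧ + ⟦ suc j ⟧ * ⟦ y ℕ.* C₁ ⟧                ≡⟨ cong (⟦ suc y ⟧ +_) (⟦⟧-homo-* (suc j) (y ℕ.* C₁)) ⟨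
    ⟦ suc y ⟧ + ⟦ suc j ℕ.* (y ℕ.* C₁) ⟧                ≡⟨ cong (λ t → ⟦ suc y ⟧ + ⟦ suc j ℕ.* t ⟧) absorbed ⟩
    ⟦ suc y ⟧ + ⟦ suc j ℕ.* ((2 ℕ.+ j) ℕ.* C₂) ⟧        ≡⟨ cong (λ t → ⟦ suc y ⟧ + ⟦ t ⟧) reassociate ⟩
    ⟦ suc y ⟧ + ⟦ (2 ℕ.+ j) ℕ.* (1 ℕ.+ j) ℕ.* C₂ ⟧      ≡⟨ cong (⟦ suc y ⟧ +_) (⟦⟧-homo-* ((2 ℕ.+ j) ℕ.* (1 ℕ.+ j)) C₂) ⟩
    ⟦ suc y ⟧ + K * ⟦ C₂ ⟧                               ∎
    where
    C₁ C₂ : ℕ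
    C₁ = (suc y ℕ.+ j) C suc j
    C₂ = (suc y ℕ.+ j) C (2 ℕ.+ j)
    reassociate : suc j ℕ.* ((2 ℕ.+ j) ℕ.* C₂) ≡ (2 ℕ.+ j) ℕ.* (1 ℕ.+ j) ℕ.* C₂
    reassociate = trans (sym (ℕP.*-assoc (suc j) (2 ℕ.+ j) C₂)) (cong (ℕ._* C₂) (ℕP.*-comm (suc j) (2 ℕ.+ j)))
    absorbed : y ℕ.* C₁ ≡ (2 ℕ.+ j) ℕ.* C₂
    absorbed = subst (λ t → y ℕ.* (t C suc j) ≡ (2 ℕ.+ j) ℕ.* (t C (2 ℕ.+ j))) (ℕP.+-suc y j) (C-absorption y (suc j))

ψ-at-1 : ∀ k → ψ k 1 ≡ 1ℚ
ψ-at-1 k = trans (cong (λ t → 1ℚ + ⟦ k ∸ 1 ⟧ * t) (*-zeroˡ ⟦ (1 ℕ.+ k ∸ 2) C (k ∸ 1) ⟧))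
  (trans (cong (1ℚ +_) (*-zeroʳ ⟦ k ∸ 1 ⟧)) (+-identityʳ 1ℚ))

ψ-expansion : ℕ → (ℕ → ℚ) → Set
ψ-expansion m c = ∀ x → ⟦ x ^ m ⟧ ≡ sum2 m (λ k → c k * ψ k x)

ψ-expansion⇒sum≡1 : ∀ m c → ψ-expansion m c → sum2 m c ≡ 1ℚ
ψ-expansion⇒sum≡1 m c expansion = begin
  sum2 m c                        ≡⟨ sum2-cong m (λ j → sym (trans (cong (c (2 ℕ.+ j) *_) (ψ-at-1 (2 ℕ.+ j))) (*-identityʳ _))) ⟩
  sum2 m (λ k → c k * ψ k 1)      ≡⟨ expansion 1 ⟨
  ⟦ 1 ^ m ⟧                       ≡⟨ cong ⟦_⟧ (ℕP.^-zeroˡ m) ⟩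
  1ℚ                              ∎
  where open ≡-Reasoning

iterSum-ψ : ∀ a n j → iterSum a (ψ (2 ℕ.+ j)) n
  ≡ ⟦ (n ℕ.+ a) C suc a ⟧ + ⟦ (2 ℕ.+ j) ℕ.* (1 ℕ.+ j) ⟧ * ⟦ (n ℕ.+ a ℕ.+ j) C (a ℕ.+ (2 ℕ.+ j)) ⟧
iterSum-ψ a n j = begin
  iterSum a (ψ (2 ℕ.+ j)) n                                     ≡⟨ iterSum-cong a n (ψ-binomial j) ⟩
  iterSum a (λ x → ⟦ x ⟧ + K * ⟦ (x ℕ.+ j) C (2 ℕ.+ j) ⟧) n     ≡⟨ iterSum-+ a n ⟦_⟧ _ ⟩
  iterSum a ⟦_⟧ n + iterSum a (λ x → K * ⟦ (x ℕ.+ j) C (2 ℕ.+ j) ⟧) n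
    ≡⟨ cong₂ _+_ (iterSum-id a n) (iterSum-*ˡ a n K _) ⟩
  E + K * iterSum a (λ x → ⟦ (x ℕ.+ j) C (2 ℕ.+ j) ⟧) n         ≡⟨ cong (λ t → E + K * t) (iterSum-binomial (ℕP.n≤1+n j) a n) ⟩
  E + K * ⟦ (n ℕ.+ (a ℕ.+ j)) C suc (a ℕ.+ suc j) ⟧              ≡⟨ cong (λ t → E + K * ⟦ t ⟧) reindex ⟩
  E + K * ⟦ (n ℕ.+ a ℕ.+ j) C (a ℕ.+ (2 ℕ.+ j)) ⟧               ∎
  where
  open ≡-Reasoning
  E K : ℚ
  E = ⟦ (n ℕ.+ a) C suc a ⟧
  K = ⟦ (2 ℕ.+ j) ℕ.* (1 ℕ.+ j) ⟧
  reindex : (n ℕ.+ (a ℕ.+ j)) C suc (a ℕ.+ suc j) ≡ (n ℕ.+ a ℕ.+ j) C (a ℕ.+ (2 ℕ.+ j))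
  reindex = cong₂ _C_ (sym (ℕP.+-assoc n a j)) (sym (ℕP.+-suc a (suc j)))

iterSum-ψ-factored : ∀ a y j → iterSum a (ψ (2 ℕ.+ j)) (suc y)
  ≡ ⟦ (suc y ℕ.+ a) C suc a ⟧ + ⟦ (suc y ℕ.+ a) C suc a ⟧ * ⟦ y ℕ.* suc a ⟧
      * (recipℕ ((a ℕ.+ (2 ℕ.+ j)) C (2 ℕ.+ j)) * ⟦ (suc y ℕ.+ a ℕ.+ (2 ℕ.+ j) ∸ 2) C j ⟧)
iterSum-ψ-factored a y j = begin
  iterSum a (ψ (2 ℕ.+ j)) n                  ≡⟨ iterSum-ψ a n j ⟩
  E + ⟦ k₂ ⟧ * ⟦ B ⟧                         ≡⟨ cong (E +_) (⟦⟧-homo-* k₂ B) ⟨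
  E + ⟦ k₂ ℕ.* B ⟧                           ≡⟨ cong (E +_) (⟦⟧-divide (k₂ ℕ.* B) _ Cb {{Cb≢0}} (C-revision y a j)) ⟩
  E + ⟦ E₀ ℕ.* (y ℕ.* suc a) ℕ.* D ⟧ * r     ≡⟨ cong (λ t → E + t * r) ⟦E₀ND⟧ ⟩
  E + E * N * ⟦ D ⟧ * r                      ≡⟨ cong (E +_) (swap (E * N) ⟦ D ⟧ r) ⟩
  E + E * N * (r * ⟦ D ⟧)                    ≡⟨ cong (λ t → E + E * N * (r * ⟦ t C j ⟧)) (m+[2+j]∸2≡m+j (n ℕ.+ a) j) ⟨
  E + E * N * (r * ⟦ (n ℕ.+ a ℕ.+ (2 ℕ.+ j) ∸ 2) C j ⟧) ∎
  where
  open ≡-Reasoning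
  n k₂ B Cb E₀ D : ℕ
  n = suc y
  k₂ = (2 ℕ.+ j) ℕ.* (1 ℕ.+ j)
  B = (n ℕ.+ a ℕ.+ j) C (a ℕ.+ (2 ℕ.+ j))
  Cb = (a ℕ.+ (2 ℕ.+ j)) C (2 ℕ.+ j)
  E₀ = (n ℕ.+ a) C suc a
  D = (n ℕ.+ a ℕ.+ j) C j
  Cb≢0 : NonZero Cb
  Cb≢0 = C-nonZero a (2 ℕ.+ j) refl
  E N r : ℚ
  E = ⟦ E₀ ⟧
  N = ⟦ y ℕ.* suc a ⟧
  r = recipℕ Cb
  ⟦E₀ND⟧ : ⟦ E₀ ℕ.* (y ℕ.* suc a) ℕ.* D ⟧ ≡ E * N * ⟦ D ⟧
  ⟦E₀ND⟧ = trans (⟦⟧-homo-* (E₀ ℕ.* (y ℕ.* suc a)) D) (cong (_* ⟦ D ⟧) (⟦⟧-homo-* E₀ (y ℕ.* suc a)))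
  swap : ∀ (p q w : ℚ) → p * q * w ≡ p * (w * q)
  swap = solve-∀ ℚ-ring

S-formula : ∀ m c → ψ-expansion m c → ∀ a y →
  ⟦ S m a (suc y) ⟧ ≡ ⟦ (suc y ℕ.+ a) C suc a ⟧
    * (1ℚ + ⟦ y ℕ.* suc a ⟧ * sum2 m (λ k → c k * recipℕ ((a ℕ.+ k) C k) * ⟦ (suc y ℕ.+ a ℕ.+ k ∸ 2) C (k ∸ 2) ⟧))
S-formula m c expansion a y = begin
  ⟦ S m a n ⟧                                              ≡⟨ ⟦S⟧ m a n ⟩
  iterSum a (λ x → ⟦ x ^ m ⟧) n                            ≡⟨ iterSum-cong a n expansion ⟩
  iterSum a (λ x → sum2 m (λ k → c k * ψ k x)) n           ≡⟨ iterSum-sum2 a n m (λ k x → c k * ψ k x) ⟩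
  sum2 m (λ k → iterSum a (λ x → c k * ψ k x) n)           ≡⟨ sum2-cong m summand ⟩
  sum2 m (λ k → c k * E + E * N * h k)                     ≡⟨ sum2-+ m (λ k → c k * E) (λ k → E * N * h k) ⟩
  sum2 m (λ k → c k * E) + sum2 m (λ k → E * N * h k)      ≡⟨ cong₂ _+_ (sum2-*ʳ m E c) (sum2-*ˡ m (E * N) h) ⟩
  sum2 m c * E + E * N * sum2 m h                          ≡⟨ cong (λ t → t * E + E * N * sum2 m h) (ψ-expansion⇒sum≡1 m c expansion) ⟩
  1ℚ * E + E * N * sum2 m h                                ≡⟨ factor E N (sum2 m h) ⟩
  E * (1ℚ + N * sum2 m h)                                  ∎
  where
  open ≡-Reasoning
  n : ℕ
  n = suc y
  E N : ℚ
  E = ⟦ (n ℕ.+ a) C suc a ⟧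
  N = ⟦ y ℕ.* suc a ⟧
  h : ℕ → ℚ
  h k = c k * recipℕ ((a ℕ.+ k) C k) * ⟦ (n ℕ.+ a ℕ.+ k ∸ 2) C (k ∸ 2) ⟧
  factor : ∀ (e x s : ℚ) → 1ℚ * e + e * x * s ≡ e * (1ℚ + x * s)
  factor = solve-∀ ℚ-ring
  distribute : ∀ (γ e x r d : ℚ) → γ * (e + e * x * (r * d)) ≡ γ * e + e * x * (γ * r * d)
  distribute = solve-∀ ℚ-ring
  summand : ∀ j → iterSum a (λ x → c (2 ℕ.+ j) * ψ (2 ℕ.+ j) x) n ≡ c (2 ℕ.+ j) * E + E * N * h (2 ℕ.+ j)
  summand j = trans (iterSum-*ˡ a n (c (2 ℕ.+ j)) (ψ (2 ℕ.+ j)))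
    (trans (cong (c (2 ℕ.+ j) *_) (iterSum-ψ-factored a y j)) (distribute (c (2 ℕ.+ j)) E N _ _))

⟦[n+1]C2⟧ : ∀ n → ⟦ (n ℕ.+ 1) C 2 ⟧ ≡ ½ * ⟦ n ℕ.* suc n ⟧
⟦[n+1]C2⟧ n = begin
  ⟦ X ⟧                 ≡⟨ *-identityˡ ⟦ X ⟧ ⟨
  ½ * ⟦ 2 ⟧ * ⟦ X ⟧     ≡⟨ *-assoc ½ ⟦ 2 ⟧ ⟦ X ⟧ ⟩
  ½ * (⟦ 2 ⟧ * ⟦ X ⟧)   ≡⟨ cong (½ *_) (trans (sym (⟦⟧-homo-* 2 X)) (cong ⟦_⟧ (2*[n+1]C2≡n*[1+n] n))) ⟩
  ½ * ⟦ n ℕ.* suc n ⟧   ∎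
  where
  open ≡-Reasoning
  X : ℕ
  X = (n ℕ.+ 1) C 2

sum-of-powers-formula : ∀ m c → ψ-expansion m c → ∀ y →
  ⟦ sum1ℕ (suc y) (λ i → i ^ m) ⟧ ≡ ½ * ⟦ suc y ℕ.* suc (suc y) ⟧
    * (1ℚ + ⟦ 2 ℕ.* y ⟧ * sum2 m (λ k → c k * recipℕ (suc k) * ⟦ (suc y ℕ.+ k ∸ 1) C (k ∸ 2) ⟧))
sum-of-powers-formula m c expansion y = trans (S-formula m c expansion 1 y)
  (cong₂ _*_ (⟦[n+1]C2⟧ (suc y)) (cong₂ (λ s t → 1ℚ + ⟦ s ⟧ * t) (ℕP.*-comm y 2) (sum2-cong m summand)))
  where
  summand : ∀ j → c (2 ℕ.+ j) * recipℕ ((1 ℕ.+ (2 ℕ.+ j)) C (2 ℕ.+ j)) * ⟦ (suc y ℕ.+ 1 ℕ.+ (2 ℕ.+ j) ∸ 2) C j ⟧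
                ≡ c (2 ℕ.+ j) * recipℕ (3 ℕ.+ j) * ⟦ (suc y ℕ.+ (2 ℕ.+ j) ∸ 1) C j ⟧
  summand j = cong₂ (λ s t → c (2 ℕ.+ j) * recipℕ s * ⟦ t C j ⟧) ([1+n]Cn≡1+n (2 ℕ.+ j)) reindex
    where
    reindex : suc y ℕ.+ 1 ℕ.+ (2 ℕ.+ j) ∸ 2 ≡ suc y ℕ.+ (2 ℕ.+ j) ∸ 1
    reindex = trans (m+[2+j]∸2≡m+j (suc y ℕ.+ 1) j)
      (trans (ℕP.+-assoc (suc y) 1 j) (sym (ℕP.+-∸-assoc (suc y) (s≤s z≤n))))

fact5 : (m : ℕ) → 2 ≤ m → (c : ℕ → ℚ)
        → (∀ x → ⟦ x ^ m ⟧ ≡ sum2 m (λ k → c k * ψ k x))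
        → ((a n : ℕ) → 1 ≤ n
            → ⟦ S m a n ⟧ ≡ ⟦ (n ℕ.+ a) C (ℕ.suc a) ⟧
                 * (1ℚ + ⟦ (n ∸ 1) ℕ.* (ℕ.suc a) ⟧
                    * sum2 m (λ k → c k * recipℕ ((a ℕ.+ k) C k) * ⟦ (n ℕ.+ a ℕ.+ k ∸ 2) C (k ∸ 2) ⟧)))
          × ((n : ℕ) → 1 ≤ n
            → ⟦ sum1ℕ n (λ i → i ^ m) ⟧ ≡ ½ * ⟦ n ℕ.* ℕ.suc n ⟧
                 * (1ℚ + ⟦ 2 ℕ.* (n ∸ 1) ⟧
                    * sum2 m (λ k → c k * recipℕ (ℕ.suc k) * ⟦ (n ℕ.+ k ∸ 1) C (k ∸ 2) ⟧)))
fact5 m _ c expansion =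
  (λ { a (suc y) _ → S-formula m c expansion a y }) , (λ { (suc y) _ → sum-of-powers-formula m c expansion y })
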